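{- Let $D\ge2$, let $N\in\{2D,2D+1\}$, and let $\Gamma$ be the cycle graph on $X=\{0,\dots,N-1\}$. Then the number of distinct distance profiles of triples in $X\times X\times X$ is $2D^2+2$ if $N=2D$, and $2D^2+2D+1$ if $N=2D+1$.
   Context: $\Gamma$ has vertex set $X=\mathbb{Z}/N\mathbb{Z}$, with $x\sim y$ iff $x-y\equiv\pm1 \pmod N$. Its path-length distance is $\partial(x,y)=\min\{r,N-r\}$ with $r\equiv x-y \pmod N$, $0\le r<N$, and its diameter is $D$. The distance profile of an ordered triple $(x,y,z)\in X^3$ is $(\partial(y,z),\partial(x,z),\partial(x,y))$. -}

module Defs where

open import Data.Nat using (ℕ; _+_; _∸_; _⊓_; _≤ᵇ_)
open import Data.Nat.Properties using (_≟_)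
open import Data.Bool using (if_then_else_)
open import Data.Fin using (Fin; toℕ)
open import Data.List using (List; allFin; map; concatMap; deduplicate; length)
open import Data.Product using (_×_; _,_)
open import Data.Product.Properties using (≡-dec)
open import Relation.Binary.Definitions using (DecidableEquality)

residue : (N : ℕ) → Fin N → Fin N → ℕ
residue N x y = if toℕ y ≤ᵇ toℕ x then toℕ x ∸ toℕ y else (N + toℕ x) ∸ toℕ y

cycDist : (N : ℕ) → Fin N → Fin N → ℕ
cycDist N x y = residue N x y ⊓ (N ∸ residue N x y)

Profile : Set
Profile = ℕ × ℕ × ℕ

profile : (N : ℕ) → Fin N → Fin N → Fin N → Profile
profile N x y z = cycDist N y z , cycDist N x z , cycDist N x y

allProfiles : (N : ℕ) → List Profile
allProfiles N =
  concatMap (λ x → concatMap (λ y → map (λ z → profile N x y z) (allFin N)) (allFin N)) (allFin N)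

_≟P_ : DecidableEquality Profile
_≟P_ = ≡-dec _≟_ (≡-dec _≟_ _≟_)

numProfiles : ℕ → ℕ
numProfiles N = length (deduplicate _≟P_ (allProfiles N))

-- Three vertices cut the cycle into arcs p, q, s with p + q + s = N, and the three
-- distances are the folded arc lengths min (p, N - p), min (q, N - q), min (s, N - s).
-- Comparing the arcs with half the cycle shows that two vertices at distances b and c
-- from a third lie at distance ∣b - c∣ or min (b + c, N - b - c) from each other;
-- placing them on the same or on opposite sides of the third vertex realises both.
-- So the profiles are the triples (a, b, c) with b, c ≤ D and a one of these two values.
-- The two values differ exactly when 1 ≤ b, c ≤ M, where M = D - 1 if N = 2D and M = D
-- if N = 2D + 1, which gives (D + 1)² + M² profiles.
module Submission where

open import Data.Bool using (true; false)
open import Data.Fin using (Fin; toℕ; fromℕ<)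
open import Data.Fin.Properties using (toℕ<n; toℕ-fromℕ<)
open import Data.List
  using (List; []; _∷_; map; allFin; length; upTo; applyUpTo; cartesianProductWith; deduplicate; _++_)
open import Data.List.Properties using (length-++; length-map; length-applyUpTo)
open import Data.List.Membership.Propositional using (_∈_; lose)
open import Data.List.Membership.Propositional.Properties
  using ( ∈-++⁺ˡ; ∈-++⁺ʳ; ∈-++⁻; ∈-upTo⁺; ∈-upTo⁻; ∈-applyUpTo⁺; ∈-applyUpTo⁻
        ; ∈-cartesianProductWith⁺; ∈-cartesianProductWith⁻; ∈-concatMap⁺; ∈-concatMap⁻
        ; ∈-map⁺; ∈-map⁻; ∈-allFin; deduplicate-∈⇔)
open import Data.List.Membership.Propositional.Properties.WithK using (unique∧set⇒bag)
open import Data.List.Relation.Binary.BagAndSetEquality using (∼bag⇒↭)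
open import Data.List.Relation.Binary.Permutation.Propositional.Properties using (↭-length)
open import Data.List.Relation.Unary.Any using (satisfied)
open import Data.List.Relation.Unary.Unique.Propositional using (Unique)
import Data.List.Relation.Unary.Unique.Propositional.Properties as Unique
import Data.List.Relation.Unary.Unique.DecPropositional.Properties as DecUnique
open import Data.Nat
open import Data.Nat.Properties
open import Algebra.Properties.CommutativeSemigroup +-commutativeSemigroup
  using (xy∙z≈yx∙z; xy∙z≈xz∙y; xy∙z≈zx∙y; xy∙z≈y∙zx; xy∙z≈z∙yx)
open import Data.Nat.Tactic.RingSolver using (solve-∀)
open import Data.Product using (_×_; _,_; proj₁; ∃-syntax)
open import Data.Sum using (_⊎_; inj₁; inj₂)
open import Function.Base using (id)
open import Function.Bundles using (_⇔_; mk⇔)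
import Function.Properties.Equivalence as ⇔
open import Relation.Binary.Definitions using (DecidableEquality)
open import Relation.Binary.PropositionalEquality
open import Relation.Nullary using (¬_; yes; no; ofʸ; ofⁿ)

open import Defs

open ≡-Reasoning

cycNorm : ℕ → ℕ → ℕ
cycNorm N u = u ⊓ (N ∸ u)

cycDistℕ : ℕ → ℕ → ℕ → ℕ
cycDistℕ N x y = cycNorm N ∣ x - y ∣

cycNorm-arc : ∀ {m n N} → m + n ≡ N → cycNorm N m ≡ m ⊓ n
cycNorm-arc {m} {n} refl = cong (m ⊓_) (m+n∸m≡n m n)

cycNorm-shortArc : ∀ {m n N} → m + n ≡ N → m ≤ n → cycNorm N m ≡ m
cycNorm-shortArc e m≤n = trans (cycNorm-arc e) (m≤n⇒m⊓n≡m m≤n)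

cycNorm-longArc : ∀ {m n N} → m + n ≡ N → n ≤ m → cycNorm N m ≡ n
cycNorm-longArc e n≤m = trans (cycNorm-arc e) (m≥n⇒m⊓n≡n n≤m)

cycNorm-complement : ∀ {m n N} → m + n ≡ N → cycNorm N m ≡ cycNorm N n
cycNorm-complement {m} {n} {N} e = begin
  cycNorm N m  ≡⟨ cycNorm-arc e ⟩
  m ⊓ n        ≡⟨ ⊓-comm m n ⟩
  n ⊓ m        ≡⟨ cycNorm-arc (trans (+-comm n m) e) ⟨
  cycNorm N n  ∎

cycNorm-short : ∀ {u D N} → D + D ≤ N → u ≤ D → cycNorm N u ≡ u
cycNorm-short {u} 2D≤N u≤D = m≤n⇒m⊓n≡m (m+n≤o⇒m≤o∸n u (≤-trans (+-mono-≤ u≤D u≤D) 2D≤N))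

cycNorm≤ : ∀ {D N} u → N ≤ suc (D + D) → cycNorm N u ≤ D
cycNorm≤ {D} {N} u N≤1+2D with u ≤? D
... | yes u≤D = ≤-trans (m⊓n≤m u (N ∸ u)) u≤D
... | no u≰D  = ≤-trans (m⊓n≤n u (N ∸ u))
                  (≤-trans (∸-mono N≤1+2D (≰⇒> u≰D)) (≤-reflexive (m+n∸m≡n D D)))

<-cycNorm : ∀ {k u N} → k < u → k + u < N → k < cycNorm N u
<-cycNorm {k} k<u k+u<N = ⊓-glb k<u (m+n≤o⇒m≤o∸n (suc k) k+u<N)

cycNorm-antipodal : ∀ {c D} → c ≤ D → cycNorm (D + D) (D + c) ≡ D ∸ c
cycNorm-antipodal {c} {D} c≤D = cycNorm-longArc arcs≡ (≤-trans (m∸n≤m D c) (m≤m+n D c))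
  where
  arcs≡ : D + c + (D ∸ c) ≡ D + D
  arcs≡ = trans (+-assoc D c (D ∸ c)) (cong (D +_) (m+[n∸m]≡n c≤D))

[o+m∸n]+[n∸m]≡o : ∀ {N x y} → x ≤ y → y ≤ N → N + x ∸ y + (y ∸ x) ≡ N
[o+m∸n]+[n∸m]≡o {N} {x} x≤y y≤N with k , refl ← m≤n⇒∃[o]m+o≡n x≤y = begin
  N + x ∸ (x + k) + (x + k ∸ x) ≡⟨ cong₂ _+_ (cong (_∸ (x + k)) (+-comm N x)) (m+n∸m≡n x k) ⟩
  x + N ∸ (x + k) + k           ≡⟨ cong (_+ k) ([m+n]∸[m+o]≡n∸o x N k) ⟩
  N ∸ k + k                     ≡⟨ m∸n+n≡m (m+n≤o⇒n≤o x y≤N) ⟩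
  N                             ∎

cycDist≡cycDistℕ : ∀ {N} (x y : Fin N) → cycDist N x y ≡ cycDistℕ N (toℕ x) (toℕ y)
cycDist≡cycDistℕ {N} x y
  with toℕ y ≤ᵇ toℕ x | ≤ᵇ-reflects-≤ (toℕ y) (toℕ x)
... | true  | ofʸ y≤x = cong (cycNorm N) (sym (m≤n⇒∣n-m∣≡n∸m y≤x))
... | false | ofⁿ y≰x = begin
  cycNorm N (N + toℕ x ∸ toℕ y) ≡⟨ cycNorm-complement ([o+m∸n]+[n∸m]≡o x≤y (<⇒≤ (toℕ<n y))) ⟩
  cycNorm N (toℕ y ∸ toℕ x)     ≡⟨ cong (cycNorm N) (m≤n⇒∣m-n∣≡n∸m x≤y) ⟨
  cycDistℕ N (toℕ x) (toℕ y)    ∎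
  where x≤y = <⇒≤ (≰⇒> y≰x)

cycDistℕ-comm : ∀ N x y → cycDistℕ N x y ≡ cycDistℕ N y x
cycDistℕ-comm N x y = cong (cycNorm N) (∣-∣-comm x y)

-- The possible distances between two vertices at distances b and c from a third one:
-- they lie on the same side of it or on opposite sides.
Admissible : ℕ → ℕ → ℕ → ℕ → Set
Admissible N a b c = a ≡ ∣ b - c ∣ ⊎ a ≡ cycNorm N (b + c)

-- Side lengths of a triangle inscribed in the cycle, whose vertices cut it into arcs p, q, s.
data Triangle (N : ℕ) : ℕ → ℕ → ℕ → Set where
  arcs : ∀ p q s → p + q + s ≡ N → Triangle N (cycNorm N p) (cycNorm N q) (cycNorm N s)

triangle-swap₁₂ : ∀ {N a b c} → Triangle N a b c → Triangle N b a c
triangle-swap₁₂ (arcs p q s e) = arcs q p s (trans (xy∙z≈yx∙z q p s) e)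

triangle-swap₂₃ : ∀ {N a b c} → Triangle N a b c → Triangle N a c b
triangle-swap₂₃ (arcs p q s e) = arcs p s q (trans (xy∙z≈xz∙y p s q) e)

-- Either q or s is at least as long as the other two arcs together, or both are short.
admissible-arcs : ∀ {N} p q s → p + (q + s) ≡ N → q + (s + p) ≡ N → s + (q + p) ≡ N →
                  Admissible N (cycNorm N p) (cycNorm N q) (cycNorm N s)
admissible-arcs {N} p q s eₚ e_q eₛ with s + p ≤? q | q + p ≤? s
... | yes long-q | _ = inj₁ (begin
  cycNorm N p                   ≡⟨ cycNorm-shortArc eₚ (≤-trans (m+n≤o⇒n≤o s long-q) (m≤m+n q s)) ⟩
  p                             ≡⟨ ∣m-m+n∣≡n s p ⟨
  ∣ s - s + p ∣                 ≡⟨ ∣-∣-comm s (s + p) ⟩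
  ∣ s + p - s ∣                 ≡⟨ cong₂ ∣_-_∣ (cycNorm-longArc e_q long-q) short-s ⟨
  ∣ cycNorm N q - cycNorm N s ∣ ∎)
  where
  short-s = cycNorm-shortArc eₛ (≤-trans (m+n≤o⇒m≤o s long-q) (m≤m+n q p))
... | no _ | yes long-s = inj₁ (begin
  cycNorm N p                   ≡⟨ cycNorm-shortArc eₚ (≤-trans (m+n≤o⇒n≤o q long-s) (m≤n+m s q)) ⟩
  p                             ≡⟨ ∣m-m+n∣≡n q p ⟨
  ∣ q - q + p ∣                 ≡⟨ cong₂ ∣_-_∣ short-q (cycNorm-longArc eₛ long-s) ⟨
  ∣ cycNorm N q - cycNorm N s ∣ ∎)
  where
  short-q = cycNorm-shortArc e_q (≤-trans (m+n≤o⇒m≤o q long-s) (m≤m+n s p))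
... | no q≰ | no s≰ = inj₂ (begin
  cycNorm N p                           ≡⟨ cycNorm-complement eₚ ⟩
  cycNorm N (q + s)                     ≡⟨ cong (cycNorm N) (cong₂ _+_ short-q short-s) ⟨
  cycNorm N (cycNorm N q + cycNorm N s) ∎)
  where
  short-q = cycNorm-shortArc e_q (<⇒≤ (≰⇒> q≰))
  short-s = cycNorm-shortArc eₛ (<⇒≤ (≰⇒> s≰))

triangle-admissible : ∀ {N a b c} → Triangle N a b c → Admissible N a b c
triangle-admissible (arcs p q s e) =
  admissible-arcs p q s (trans (sym (+-assoc p q s)) e) (trans (sym (xy∙z≈y∙zx p q s)) e)
                  (trans (sym (xy∙z≈z∙yx p q s)) e)

consecutive-arcs : ∀ {N} i j → i + j ≤ N →
                   Triangle N (cycNorm N j) (cycNorm N (i + j)) (cycNorm N i)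
consecutive-arcs {N} i j i+j≤N with l , e ← m≤n⇒∃[o]m+o≡n i+j≤N =
  subst (λ t → Triangle N (cycNorm N j) t (cycNorm N i))
        (cycNorm-complement (trans (+-comm l (i + j)) e))
        (arcs j l i (trans (xy∙z≈zx∙y j l i) e))

sorted-triangle : ∀ {N x y z} → x ≤ y → y ≤ z → z < N →
                  Triangle N (cycDistℕ N y z) (cycDistℕ N x z) (cycDistℕ N x y)
sorted-triangle {N} {x} x≤y y≤z z<N
  with i , refl ← m≤n⇒∃[o]m+o≡n x≤y | j , refl ← m≤n⇒∃[o]m+o≡n y≤z
  rewrite ∣m-m+n∣≡n (x + i) j | +-assoc x i j | ∣m-m+n∣≡n x (i + j) | ∣m-m+n∣≡n x i
  = consecutive-arcs i j (m+n≤o⇒n≤o x (<⇒≤ z<N))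

wlog-sorted : (P : ℕ → ℕ → ℕ → Set) →
              (∀ {x y z} → P x y z → P y x z) →
              (∀ {x y z} → P x y z → P x z y) →
              (∀ {x y z} → x ≤ y → y ≤ z → P x y z) →
              ∀ x y z → P x y z
wlog-sorted P swap₁₂ swap₂₃ sorted x y z with ≤-total x y | ≤-total y z | ≤-total x z
... | inj₁ x≤y | inj₁ y≤z | _        = sorted x≤y y≤z
... | inj₁ x≤y | inj₂ z≤y | inj₁ x≤z = swap₂₃ (sorted x≤z z≤y)
... | inj₁ x≤y | inj₂ z≤y | inj₂ z≤x = swap₂₃ (swap₁₂ (sorted z≤x x≤y))
... | inj₂ y≤x | _        | inj₁ x≤z = swap₁₂ (sorted y≤x x≤z)
... | inj₂ y≤x | inj₁ y≤z | inj₂ z≤x = swap₁₂ (swap₂₃ (sorted y≤z z≤x))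
... | inj₂ y≤x | inj₂ z≤y | inj₂ z≤x = swap₁₂ (swap₂₃ (swap₁₂ (sorted z≤y y≤x)))

triangle : ∀ {N} x y z → x < N → y < N → z < N →
           Triangle N (cycDistℕ N y z) (cycDistℕ N x z) (cycDistℕ N x y)
triangle {N} = wlog-sorted P swap₁₂ swap₂₃ (λ x≤y y≤z _ _ z<N → sorted-triangle x≤y y≤z z<N)
  where
  P : ℕ → ℕ → ℕ → Set
  P x y z = x < N → y < N → z < N →
            Triangle N (cycDistℕ N y z) (cycDistℕ N x z) (cycDistℕ N x y)
  swap₁₂ : ∀ {x y z} → P x y z → P y x z
  swap₁₂ {x} {y} t y<N x<N z<N =
    subst (Triangle N _ _) (cycDistℕ-comm N x y) (triangle-swap₁₂ (t x<N y<N z<N))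
  swap₂₃ : ∀ {x y z} → P x y z → P x z y
  swap₂₃ {x} {y} {z} t x<N z<N y<N =
    subst (λ d → Triangle N d _ _) (cycDistℕ-comm N y z) (triangle-swap₂₃ (t x<N y<N z<N))

profile-admissible : ∀ {N} (x y z : Fin N) →
                     Admissible N (cycDist N y z) (cycDist N x z) (cycDist N x y)
profile-admissible x y z
  rewrite cycDist≡cycDistℕ y z | cycDist≡cycDistℕ x z | cycDist≡cycDistℕ x y =
  triangle-admissible (triangle (toℕ x) (toℕ y) (toℕ z) (toℕ<n x) (toℕ<n y) (toℕ<n z))

∈-allProfiles⁺ : ∀ {N} (x y z : Fin N) → profile N x y z ∈ allProfiles N
∈-allProfiles⁺ x y z =
  ∈-concatMap⁺ _ (lose (∈-allFin x) (∈-concatMap⁺ _ (lose (∈-allFin y) (∈-map⁺ _ (∈-allFin z)))))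

∈-allProfiles⁻ : ∀ {N p} → p ∈ allProfiles N → ∃[ x ] ∃[ y ] ∃[ z ] p ≡ profile N x y z
∈-allProfiles⁻ {N} p∈
  with x , p∈x ← satisfied (∈-concatMap⁻ _ {xs = allFin N} p∈)
  with y , p∈xy ← satisfied (∈-concatMap⁻ _ {xs = allFin N} p∈x)
  with z , _ , p≡ ← ∈-map⁻ _ p∈xy
  = x , y , z , p≡

cycDist-fromℕ< : ∀ {N x y} (x<N : x < N) (y<N : y < N) →
                 cycDist N (fromℕ< x<N) (fromℕ< y<N) ≡ cycDistℕ N x y
cycDist-fromℕ< x<N y<N =
  trans (cycDist≡cycDistℕ (fromℕ< x<N) (fromℕ< y<N)) (cong₂ (cycDistℕ _) (toℕ-fromℕ< x<N) (toℕ-fromℕ< y<N))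

profile-fromℕ< : ∀ {N x y z} (x<N : x < N) (y<N : y < N) (z<N : z < N) →
                 profile N (fromℕ< x<N) (fromℕ< y<N) (fromℕ< z<N)
                   ≡ (cycDistℕ N y z , cycDistℕ N x z , cycDistℕ N x y)
profile-fromℕ< x<N y<N z<N =
  cong₂ _,_ (cycDist-fromℕ< y<N z<N) (cong₂ _,_ (cycDist-fromℕ< x<N z<N) (cycDist-fromℕ< x<N y<N))

diff∈allProfiles : ∀ {N b c} → b < N → c < N →
                   (cycNorm N ∣ b - c ∣ , cycNorm N b , cycNorm N c) ∈ allProfiles N
diff∈allProfiles {N} {b} {c} b<N c<N =
  subst (_∈ allProfiles N)
        (trans (profile-fromℕ< 0<N c<N b<N)
               (cong (λ d → d , cycNorm N b , cycNorm N c) (cycDistℕ-comm N c b)))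
        (∈-allProfiles⁺ (fromℕ< 0<N) (fromℕ< c<N) (fromℕ< b<N))
  where 0<N = ≤-<-trans z≤n b<N

sum∈allProfiles : ∀ {N b c} → 0 < b → b + c ≤ N →
                  (cycNorm N (b + c) , cycNorm N b , cycNorm N c) ∈ allProfiles N
sum∈allProfiles {N} {b} {c} 0<b b+c≤N =
  subst (_∈ allProfiles N)
        (trans (profile-fromℕ< 0<N c<N -b<N)
               (cong₂ _,_ folded (cong (λ d → d , cycNorm N c) reflected)))
        (∈-allProfiles⁺ (fromℕ< 0<N) (fromℕ< c<N) (fromℕ< -b<N))
  where
  b≤N = m+n≤o⇒m≤o b b+c≤N
  c≤N∸b = m+n≤o⇒m≤o∸n c (subst (_≤ N) (+-comm b c) b+c≤N)
  -b<N : N ∸ b < N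
  -b<N = ∸-monoʳ-< 0<b b≤N
  c<N = ≤-<-trans c≤N∸b -b<N
  0<N = ≤-<-trans z≤n c<N
  folded : cycDistℕ N c (N ∸ b) ≡ cycNorm N (b + c)
  folded = begin
    cycNorm N ∣ c - N ∸ b ∣  ≡⟨ cong (cycNorm N) (m≤n⇒∣m-n∣≡n∸m c≤N∸b) ⟩
    cycNorm N (N ∸ b ∸ c)    ≡⟨ cong (cycNorm N) (∸-+-assoc N b c) ⟩
    cycNorm N (N ∸ (b + c))  ≡⟨ cycNorm-complement (m∸n+n≡m b+c≤N) ⟩
    cycNorm N (b + c)        ∎
  reflected : cycNorm N (N ∸ b) ≡ cycNorm N b
  reflected = cycNorm-complement (m∸n+n≡m b≤N)

CycleProfile : ℕ → ℕ → Profile → Set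
CycleProfile D N (a , b , c) = b ≤ D × c ≤ D × Admissible N a b c

profile-isCycleProfile : ∀ {D N} → N ≤ suc (D + D) → (x y z : Fin N) →
                         CycleProfile D N (profile N x y z)
profile-isCycleProfile {N = N} N≤1+2D x y z =
  cycNorm≤ (residue N x z) N≤1+2D , cycNorm≤ (residue N x y) N≤1+2D , profile-admissible x y z

∈-allProfiles⇒cycleProfile : ∀ {D N p} → N ≤ suc (D + D) → p ∈ allProfiles N → CycleProfile D N p
∈-allProfiles⇒cycleProfile {D} {N} N≤1+2D p∈ =
  let x , y , z , p≡ = ∈-allProfiles⁻ p∈ in
  subst (CycleProfile D N) (sym p≡) (profile-isCycleProfile N≤1+2D x y z)

cycleProfile⇒∈allProfiles : ∀ {D N p} → D < N → D + D ≤ N → CycleProfile D N p → p ∈ allProfiles N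
cycleProfile⇒∈allProfiles {D} {N} D<N 2D≤N (b≤D , c≤D , adm) =
  subst (λ bc → (_ , bc) ∈ allProfiles N) (cong₂ _,_ (short b≤D) (short c≤D)) (realize b≤D c≤D adm)
  where
  short : ∀ {u} → u ≤ D → cycNorm N u ≡ u
  short = cycNorm-short 2D≤N
  realize : ∀ {a b c} → b ≤ D → c ≤ D → Admissible N a b c →
            (a , cycNorm N b , cycNorm N c) ∈ allProfiles N
  realize {b = b} {c} b≤D c≤D (inj₁ refl) =
    subst (λ a → (a , cycNorm N b , cycNorm N c) ∈ allProfiles N)
          (short (≤-trans (∣m-n∣≤m⊔n b c) (⊔-lub b≤D c≤D)))
          (diff∈allProfiles (≤-<-trans b≤D D<N) (≤-<-trans c≤D D<N))
  -- For b = 0 both values are cycNorm N c by computation.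
  realize {b = zero}  b≤D c≤D (inj₂ refl) =
    diff∈allProfiles (≤-<-trans b≤D D<N) (≤-<-trans c≤D D<N)
  realize {b = suc _} b≤D c≤D (inj₂ refl) =
    sum∈allProfiles (s≤s z≤n) (≤-trans (+-mono-≤ b≤D c≤D) 2D≤N)

∈-allProfiles⇔ : ∀ {D N p} → D < N → D + D ≤ N → N ≤ suc (D + D) →
                 p ∈ allProfiles N ⇔ CycleProfile D N p
∈-allProfiles⇔ D<N 2D≤N N≤1+2D =
  mk⇔ (∈-allProfiles⇒cycleProfile N≤1+2D) (cycleProfile⇒∈allProfiles D<N 2D≤N)

length-cartesianProductWith : ∀ {A B C : Set} (f : A → B → C) xs ys →
  length (cartesianProductWith f xs ys) ≡ length xs * length ys
length-cartesianProductWith f []       ys = refl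
length-cartesianProductWith f (x ∷ xs) ys = begin
  length (map (f x) ys ++ cartesianProductWith f xs ys)  ≡⟨ length-++ (map (f x) ys) ⟩
  length (map (f x) ys) + length (cartesianProductWith f xs ys)
    ≡⟨ cong₂ _+_ (length-map (f x) ys) (length-cartesianProductWith f xs ys) ⟩
  length ys + length xs * length ys                      ∎

length-deduplicate : ∀ {A : Set} (_≟_ : DecidableEquality A) {xs ys : List A} → Unique xs →
                     (∀ {v} → v ∈ xs ⇔ v ∈ ys) → length (deduplicate _≟_ ys) ≡ length xs
length-deduplicate _≟_ {xs} {ys} xs! xs⇔ys =
  sym (↭-length (∼bag⇒↭ (unique∧set⇒bag xs! (DecUnique.deduplicate-! _≟_ ys)
                                          (⇔.trans xs⇔ys (deduplicate-∈⇔ _≟_)))))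

∣b-c∣<cycNorm[b+c]-≤ : ∀ {N b c} → 0 < b → b ≤ c → c + c < N → ∣ b - c ∣ < cycNorm N (b + c)
∣b-c∣<cycNorm[b+c]-≤ {N} {b} 0<b b≤c 2c<N with k , refl ← m≤n⇒∃[o]m+o≡n b≤c =
  subst (_< cycNorm N (b + (b + k))) (sym (∣m-m+n∣≡n b k))
        (<-cycNorm (≤-trans (+-monoˡ-≤ k 0<b) (m≤n+m (b + k) b))
                   (subst (_< N) (rearrange b k) 2c<N))
  where
  rearrange : ∀ b k → (b + k) + (b + k) ≡ k + (b + (b + k))
  rearrange = solve-∀

∣b-c∣<cycNorm[b+c] : ∀ {N b c} → 0 < b → 0 < c → b + b < N → c + c < N →
                     ∣ b - c ∣ < cycNorm N (b + c)
∣b-c∣<cycNorm[b+c] {N} {b} {c} 0<b 0<c 2b<N 2c<N with ≤-total b c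
... | inj₁ b≤c = ∣b-c∣<cycNorm[b+c]-≤ 0<b b≤c 2c<N
... | inj₂ c≤b = subst₂ _<_ (∣-∣-comm c b) (cong (cycNorm N) (+-comm c b))
                        (∣b-c∣<cycNorm[b+c]-≤ 0<c c≤b 2b<N)

cycNorm[b+c]≡∣b-c∣ : ∀ {D M b c} → D ≤ suc M → b ≤ D → c ≤ D → M < b ⊎ M < c →
                     cycNorm (D + suc M) (b + c) ≡ ∣ b - c ∣
cycNorm[b+c]≡∣b-c∣ D≤1+M b≤D c≤D (inj₁ M<b)
  with refl ← ≤-antisym b≤D (≤-trans D≤1+M M<b) | refl ← ≤-antisym D≤1+M (≤-trans M<b b≤D)
  = trans (cycNorm-antipodal c≤D) (sym (m≤n⇒∣n-m∣≡n∸m c≤D))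
cycNorm[b+c]≡∣b-c∣ {D} {M} {b} {c} D≤1+M b≤D c≤D (inj₂ M<c) = begin
  cycNorm (D + suc M) (b + c) ≡⟨ cong (cycNorm (D + suc M)) (+-comm b c) ⟩
  cycNorm (D + suc M) (c + b) ≡⟨ cycNorm[b+c]≡∣b-c∣ D≤1+M c≤D b≤D (inj₁ M<c) ⟩
  ∣ c - b ∣                   ≡⟨ ∣-∣-comm c b ⟩
  ∣ b - c ∣                   ∎

diffProfiles : ℕ → List Profile
diffProfiles D = cartesianProductWith (λ b c → ∣ b - c ∣ , b , c) (upTo (suc D)) (upTo (suc D))

sumProfiles : ℕ → ℕ → List Profile
sumProfiles N M =
  cartesianProductWith (λ b c → cycNorm N (b + c) , b , c) (applyUpTo suc M) (applyUpTo suc M)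

cycleProfiles : ℕ → ℕ → List Profile
cycleProfiles D M = diffProfiles D ++ sumProfiles (D + suc M) M

length-cycleProfiles : ∀ D M → length (cycleProfiles D M) ≡ suc D * suc D + M * M
length-cycleProfiles D M = begin
  length (diffProfiles D ++ sumProfiles N M)           ≡⟨ length-++ (diffProfiles D) ⟩
  length (diffProfiles D) + length (sumProfiles N M)
    ≡⟨ cong₂ _+_ (length-cartesianProductWith _ (upTo (suc D)) (upTo (suc D)))
                 (length-cartesianProductWith _ (applyUpTo suc M) (applyUpTo suc M)) ⟩
  length (upTo (suc D)) * length (upTo (suc D)) + length (applyUpTo suc M) * length (applyUpTo suc M)
    ≡⟨ cong₂ _+_ (cong₂ _*_ (length-applyUpTo id (suc D)) (length-applyUpTo id (suc D)))
                 (cong₂ _*_ (length-applyUpTo suc M) (length-applyUpTo suc M)) ⟩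
  suc D * suc D + M * M                                ∎
  where N = D + suc M

last-two-injective : ∀ {a a′ b b′ c c′ : ℕ} → (a , b , c) ≡ (a′ , b′ , c′) → b ≡ b′ × c ≡ c′
last-two-injective refl = refl , refl

cycleProfiles-unique : ∀ {D M} → M ≤ D → Unique (cycleProfiles D M)
cycleProfiles-unique {D} {M} M≤D =
  Unique.++⁺ (Unique.cartesianProductWith⁺ _ last-two-injective upTo! upTo!)
             (Unique.cartesianProductWith⁺ _ last-two-injective suc! suc!)
             disjoint
  where
  N = D + suc M
  upTo! = Unique.upTo⁺ (suc D)
  suc! = Unique.applyUpTo⁺₁ suc M (λ i<j _ → <⇒≢ (s≤s i<j))
  2u<N : ∀ {u} → u ≤ M → u + u < N
  2u<N u≤M = ≤-<-trans (+-mono-≤ u≤M u≤M) (+-mono-≤-< M≤D (n<1+n M))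
  disjoint : ∀ {v} → ¬ (v ∈ diffProfiles D × v ∈ sumProfiles N M)
  disjoint (v∈diff , v∈sum)
    with b , c , _ , _ , refl ← ∈-cartesianProductWith⁻ _ (upTo (suc D)) (upTo (suc D)) v∈diff
    with _ , _ , b∈ , c∈ , e ← ∈-cartesianProductWith⁻ _ (applyUpTo suc M) (applyUpTo suc M) v∈sum
    with i , i<M , refl ← ∈-applyUpTo⁻ suc b∈ | j , j<M , refl ← ∈-applyUpTo⁻ suc c∈
    with refl , refl ← last-two-injective e
    = <-irrefl (cong proj₁ e) (∣b-c∣<cycNorm[b+c] (s≤s z≤n) (s≤s z≤n) (2u<N i<M) (2u<N j<M))

∈-cycleProfiles⇔ : ∀ {D M p} → M ≤ D → D ≤ suc M →
                   p ∈ cycleProfiles D M ⇔ CycleProfile D (D + suc M) p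
∈-cycleProfiles⇔ {D} {M} M≤D D≤1+M = mk⇔ to from
  where
  N = D + suc M
  to : ∀ {p} → p ∈ cycleProfiles D M → CycleProfile D N p
  to p∈ with ∈-++⁻ (diffProfiles D) p∈
  ... | inj₁ p∈diff
    with _ , _ , b∈ , c∈ , refl ← ∈-cartesianProductWith⁻ _ (upTo (suc D)) (upTo (suc D)) p∈diff
    = s≤s⁻¹ (∈-upTo⁻ b∈) , s≤s⁻¹ (∈-upTo⁻ c∈) , inj₁ refl
  ... | inj₂ p∈sum
    with _ , _ , b∈ , c∈ , refl ← ∈-cartesianProductWith⁻ _ (applyUpTo suc M) (applyUpTo suc M) p∈sum
    with _ , i<M , refl ← ∈-applyUpTo⁻ suc b∈ | _ , j<M , refl ← ∈-applyUpTo⁻ suc c∈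
    = ≤-trans i<M M≤D , ≤-trans j<M M≤D , inj₂ refl
  diff∈ : ∀ {b c} → b ≤ D → c ≤ D → (∣ b - c ∣ , b , c) ∈ cycleProfiles D M
  diff∈ b≤D c≤D = ∈-++⁺ˡ (∈-cartesianProductWith⁺ _ (∈-upTo⁺ (s≤s b≤D)) (∈-upTo⁺ (s≤s c≤D)))
  short : ∀ {u} → u ≤ D → cycNorm N u ≡ u
  short = cycNorm-short (+-monoʳ-≤ D D≤1+M)
  collapsed : ∀ {b c} → b ≤ D → c ≤ D → M < b ⊎ M < c →
              (cycNorm N (b + c) , b , c) ∈ cycleProfiles D M
  collapsed {b} {c} b≤D c≤D M<b⊎M<c =
    subst (λ a → (a , b , c) ∈ cycleProfiles D M)
          (sym (cycNorm[b+c]≡∣b-c∣ D≤1+M b≤D c≤D M<b⊎M<c)) (diff∈ b≤D c≤D)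
  sum∈ : ∀ {b c} → b ≤ D → c ≤ D → (cycNorm N (b + c) , b , c) ∈ cycleProfiles D M
  sum∈ {zero} {c} b≤D c≤D =
    subst (λ a → (a , 0 , c) ∈ cycleProfiles D M) (sym (short c≤D)) (diff∈ b≤D c≤D)
  sum∈ {suc b} {zero} b≤D c≤D =
    subst (λ a → (a , suc b , 0) ∈ cycleProfiles D M)
          (sym (trans (cong (cycNorm N) (+-identityʳ (suc b))) (short b≤D))) (diff∈ b≤D c≤D)
  sum∈ {suc b} {suc c} b≤D c≤D with suc b ≤? M | suc c ≤? M
  ... | yes b≤M | yes c≤M =
    ∈-++⁺ʳ (diffProfiles D) (∈-cartesianProductWith⁺ _ (∈-applyUpTo⁺ suc b≤M) (∈-applyUpTo⁺ suc c≤M))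
  ... | no b≰M  | _       = collapsed b≤D c≤D (inj₁ (≰⇒> b≰M))
  ... | yes _   | no c≰M  = collapsed b≤D c≤D (inj₂ (≰⇒> c≰M))
  from : ∀ {p} → CycleProfile D N p → p ∈ cycleProfiles D M
  from (b≤D , c≤D , inj₁ refl) = diff∈ b≤D c≤D
  from (b≤D , c≤D , inj₂ refl) = sum∈ b≤D c≤D

numProfiles-cycle : ∀ {D M} → M ≤ D → D ≤ suc M →
                    numProfiles (D + suc M) ≡ suc D * suc D + M * M
numProfiles-cycle {D} {M} M≤D D≤1+M = begin
  numProfiles N              ≡⟨ length-deduplicate _≟P_ (cycleProfiles-unique M≤D) same-members ⟩
  length (cycleProfiles D M) ≡⟨ length-cycleProfiles D M ⟩
  suc D * suc D + M * M      ∎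
  where
  N = D + suc M
  N≤1+2D : N ≤ suc (D + D)
  N≤1+2D = ≤-trans (≤-reflexive (+-suc D M)) (s≤s (+-monoʳ-≤ D M≤D))
  same-members : ∀ {p} → p ∈ cycleProfiles D M ⇔ p ∈ allProfiles N
  same-members = ⇔.trans (∈-cycleProfiles⇔ M≤D D≤1+M)
                         (⇔.sym (∈-allProfiles⇔ (m<m+n D (s≤s z≤n)) (+-monoʳ-≤ D D≤1+M) N≤1+2D))

lemma5p7 : (D N : ℕ) → 2 ≤ D →
    (N ≡ 2 * D → numProfiles N ≡ 2 * D * D + 2) ×
    (N ≡ 2 * D + 1 → numProfiles N ≡ 2 * D * D + 2 * D + 1)
lemma5p7 zero    N ()
lemma5p7 D@(suc M) N _ = even , odd
  where
  even : N ≡ 2 * D → numProfiles N ≡ 2 * D * D + 2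
  even refl = begin
    numProfiles (2 * D)     ≡⟨ cong numProfiles (double≡ M) ⟩
    numProfiles (D + suc M) ≡⟨ numProfiles-cycle (n≤1+n M) ≤-refl ⟩
    suc D * suc D + M * M   ≡⟨ even-count M ⟩
    2 * D * D + 2           ∎
    where
    double≡ : ∀ m → 2 * suc m ≡ suc m + suc m
    double≡ = solve-∀
    even-count : ∀ m → suc (suc m) * suc (suc m) + m * m ≡ 2 * suc m * suc m + 2
    even-count = solve-∀
  odd : N ≡ 2 * D + 1 → numProfiles N ≡ 2 * D * D + 2 * D + 1
  odd refl = begin
    numProfiles (2 * D + 1) ≡⟨ cong numProfiles (double+1≡ D) ⟩
    numProfiles (D + suc D) ≡⟨ numProfiles-cycle ≤-refl (n≤1+n D) ⟩
    suc D * suc D + D * D   ≡⟨ odd-count D ⟩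
    2 * D * D + 2 * D + 1   ∎
    where
    double+1≡ : ∀ d → 2 * d + 1 ≡ d + suc d
    double+1≡ = solve-∀
    odd-count : ∀ d → suc d * suc d + d * d ≡ 2 * d * d + 2 * d + 1
    odd-count = solve-∀
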